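{- Consider the following four graphs on six vertices $\{a,b,c,d,e,f\}$: (1) $N(a)=\{b,d\}$, $N(b)=\{a,c,e\}$, $N(c)=\{b\}$, $N(d)=\{a,e\}$, $N(e)=\{b,d,f\}$, $N(f)=\{e\}$; (2) $N(a)=\{b,d\}$, $N(b)=\{a,c,e,f\}$, $N(c)=N(f)=\{b,e\}$, $N(d)=\{a,e\}$, $N(e)=\{b,c,d,f\}$; (3) $N(a)=\{b,f\}$, $N(b)=\{a,c,d,f\}$, $N(c)=\{b,d\}$, $N(d)=\{b,c,e,f\}$, $N(e)=\{d,f\}$, $N(f)=\{a,b,d,e\}$; (4) $N(a)=\{b,f\}$, $N(b)=\{a,c,e,f\}$, $N(c)=\{b,d,e,f\}$, $N(d)=\{c,e\}$, $N(e)=\{b,c,d,f\}$, $N(f)=\{a,b,c,e\}$. For each of these graphs, the graph obtained by adding a new vertex $w$ and a single edge joining $w$ to a vertex of maximum degree is not a zero-divisor graph.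
   Context: For a commutative semigroup $S$ with zero, its zero-divisor graph $\Gamma(S)$ has as vertices the nonzero zero-divisors of $S$, distinct $u,v$ being adjacent iff $uv=0$. A graph is a zero-divisor graph if it is isomorphic to $\Gamma(S)$ for some commutative semigroup $S$ with zero. $N(v)$ denotes the set of neighbors of $v$. (The four listed graphs are known to satisfy condition $\star$ but not to be zero-divisor graphs, where condition $\star$ means: for any nonadjacent distinct $u,v$ there is $z$ with $N(u)\cup N(v)\subseteq N(z)\cup\{z\}$.) -}

module Defs where

open import Level using (Level) renaming (suc to lsuc)
open import Data.Nat using (ℕ; _≤_) renaming (suc to 1+)
open import Data.Fin using (Fin; zero; suc; inject₁; fromℕ; _≟_)
open import Data.List using (List; []; _∷_; _++_; map; length)
open import Data.List.Membership.Propositional using (_∈_)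
open import Data.Product using (Σ; _×_; ∃)
open import Relation.Nullary using (¬_; yes; no)
open import Relation.Binary.PropositionalEquality using (_≡_; _≢_)
open import Function.Bundles using (_⇔_)

record CommSemigroupWithZero (ℓ : Level) : Set (lsuc ℓ) where
  field
    Carrier : Set ℓ
    _·_     : Carrier → Carrier → Carrier
    0#      : Carrier
    assoc   : ∀ x y z → (x · y) · z ≡ x · (y · z)
    comm    : ∀ x y → x · y ≡ y · x
    zeroˡ   : ∀ x → 0# · x ≡ 0#

  IsNZZD : Carrier → Set ℓ
  IsNZZD x = (x ≢ 0#) × ∃ λ y → (y ≢ 0#) × (x · y ≡ 0#)

Graph : ℕ → Set
Graph n = Fin n → List (Fin n)

Adj : ∀ {n} → Graph n → Fin n → Fin n → Set
Adj N u v = v ∈ N u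

degree : ∀ {n} → Graph n → Fin n → ℕ
degree N v = length (N v)

IsMaxDegree : ∀ {n} → Graph n → Fin n → Set
IsMaxDegree N v = ∀ u → degree N u ≤ degree N v

record IsoToΓ {ℓ} {n} (G : Graph n) (S : CommSemigroupWithZero ℓ) : Set ℓ where
  open CommSemigroupWithZero S
  field
    φ       : Fin n → Carrier
    φ-vert  : ∀ i → IsNZZD (φ i)
    φ-inj   : ∀ i j → φ i ≡ φ j → i ≡ j
    φ-surj  : ∀ x → IsNZZD x → Σ (Fin n) λ i → φ i ≡ x
    φ-adj   : ∀ i j → i ≢ j → (Adj G i j ⇔ (φ i · φ j ≡ 0#))

IsZeroDivisorGraph : ∀ {n} (ℓ : Level) → Graph n → Set (lsuc ℓ)
IsZeroDivisorGraph ℓ G = Σ (CommSemigroupWithZero ℓ) (IsoToΓ G)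

-- Adding a new vertex w joined by a single edge to the vertex v.
-- Convention: the new vertex w is `zero`, an old vertex i becomes `suc i`.
addPendant : ∀ {n} → Graph n → Fin n → Graph (1+ n)
addPendant G v zero = suc v ∷ []
addPendant G v (suc i) with i ≟ v
... | yes _ = zero ∷ map suc (G i)
... | no  _ = map suc (G i)

a b c d e f : Fin 6
a = zero
b = suc zero
c = suc (suc zero)
d = suc (suc (suc zero))
e = suc (suc (suc (suc zero)))
f = suc (suc (suc (suc (suc zero))))

G₁ : Graph 6
G₁ zero = b ∷ d ∷ []
G₁ (suc zero) = a ∷ c ∷ e ∷ []
G₁ (suc (suc zero)) = b ∷ []
G₁ (suc (suc (suc zero))) = a ∷ e ∷ []
G₁ (suc (suc (suc (suc zero)))) = b ∷ d ∷ f ∷ []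
G₁ (suc (suc (suc (suc (suc zero))))) = e ∷ []

G₂ : Graph 6
G₂ zero = b ∷ d ∷ []
G₂ (suc zero) = a ∷ c ∷ e ∷ f ∷ []
G₂ (suc (suc zero)) = b ∷ e ∷ []
G₂ (suc (suc (suc zero))) = a ∷ e ∷ []
G₂ (suc (suc (suc (suc zero)))) = b ∷ c ∷ d ∷ f ∷ []
G₂ (suc (suc (suc (suc (suc zero))))) = b ∷ e ∷ []

G₃ : Graph 6
G₃ zero = b ∷ f ∷ []
G₃ (suc zero) = a ∷ c ∷ d ∷ f ∷ []
G₃ (suc (suc zero)) = b ∷ d ∷ []
G₃ (suc (suc (suc zero))) = b ∷ c ∷ e ∷ f ∷ []
G₃ (suc (suc (suc (suc zero)))) = d ∷ f ∷ []
G₃ (suc (suc (suc (suc (suc zero))))) = a ∷ b ∷ d ∷ e ∷ []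

G₄ : Graph 6
G₄ zero = b ∷ f ∷ []
G₄ (suc zero) = a ∷ c ∷ e ∷ f ∷ []
G₄ (suc (suc zero)) = b ∷ d ∷ e ∷ f ∷ []
G₄ (suc (suc (suc zero))) = c ∷ e ∷ []
G₄ (suc (suc (suc (suc zero)))) = b ∷ c ∷ d ∷ f ∷ []
G₄ (suc (suc (suc (suc (suc zero))))) = a ∷ b ∷ c ∷ e ∷ []

graphs : Fin 4 → Graph 6
graphs zero = G₁
graphs (suc zero) = G₂
graphs (suc (suc zero)) = G₃
graphs (suc (suc (suc zero))) = G₄

-- Inside a commutative semigroup S with zero, the product of two
-- zero-divisors is again 0 or a nonzero zero-divisor. So if G ≅ Γ(S) has n
-- vertices, S restricts (classically) to a commutative, associative
-- multiplication on n + 1 elements in which 0 is absorbing and two distinct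
-- vertices multiply to 0 exactly when they are adjacent. For each of the
-- eleven graphs obtained by attaching a pendant vertex w at a vertex of
-- maximum degree, a case analysis on a few products, closed off by
-- associativity, shows that no such table on 8 elements exists.

module Submission where

open import Defs hiding (a; b; c; d; e; f)
open import Level using (Level)
open import Function using (_∘_)
open import Function.Bundles using (Equivalence)
open import Data.Bool using (Bool; true; false; T; not; _∨_)
open import Data.Bool.Properties using (T-∨; T?)
open import Data.Empty using (⊥-elim)
open import Data.Fin using (Fin; zero; suc; _≟_)
open import Data.Fin.Properties using (all?)
open import Data.Fin.Patterns using (0F; 1F; 2F; 3F; 4F; 5F)
open import Data.Maybe using (Maybe; just; nothing)
open import Data.Nat using (ℕ; suc; _<?_)
open import Data.Nat.Properties using (<⇒≱)
open import Data.Product using (Σ; _,_; proj₁; proj₂)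
open import Data.Sum using (inj₁; inj₂)
open import Data.Vec using (Vec; []; _∷_; lookup)
open import Relation.Nullary using (¬_; Dec; yes; no)
open import Relation.Nullary.Decidable using (True; isYes; toWitness; toWitnessFalse)
open import Relation.Binary.PropositionalEquality
import Data.List.Membership.DecPropositional as Membership

¬¬-pull-Fin : ∀ {p n} {P : Fin n → Set p} → (∀ i → ¬ ¬ P i) → ¬ ¬ (∀ i → P i)
¬¬-pull-Fin {n = 0}     _   k = k λ ()
¬¬-pull-Fin {n = suc n} ¬¬P k =
  ¬¬P zero λ P₀ → ¬¬-pull-Fin (¬¬P ∘ suc) λ P₊ → k λ { zero → P₀ ; (suc i) → P₊ i }

T-not⇒¬T : ∀ {x} → T (not x) → ¬ T x
T-not⇒¬T {false} _ ()

allᵇ : ∀ {m} → (Fin m → Bool) → Bool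
allᵇ p = isYes (all? (T? ∘ p))

allᵇ-sound : ∀ {m} (p : Fin m → Bool) → T (allᵇ p) → ∀ i → T (p i)
allᵇ-sound p = toWitness {a? = all? (T? ∘ p)}

isZero : ∀ {m} → Fin m → Bool
isZero zero    = true
isZero (suc _) = false

isZero⇒≡zero : ∀ {m} {x : Fin (suc m)} → T (isZero x) → x ≡ zero
isZero⇒≡zero {x = zero} _ = refl

adjacent? : ∀ {n} (G : Graph n) i j → Dec (Adj G i j)
adjacent? G i j = Membership._∈?_ _≟_ j (G i)

-- The element zero stands for 0 ∈ S and suc i for the vertex i.
permitted : ∀ {n} → Graph n → (x y z : Fin (suc n)) → Bool
permitted G zero    _       z = isZero z
permitted G (suc _) zero    z = isZero z
permitted G (suc i) (suc j) z with i ≟ j | adjacent? G i j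
... | yes _ | _     = true
... | no  _ | yes _ = isZero z
... | no  _ | no  _ = not (isZero z)

record ZeroDivisorTable {n} (G : Graph n) : Set where
  field
    _*_         : Fin (suc n) → Fin (suc n) → Fin (suc n)
    *-comm      : ∀ x y → x * y ≡ y * x
    *-assoc     : ∀ x y z → (x * y) * z ≡ x * (y * z)
    permitted-* : ∀ x y → T (permitted G x y (x * y))

module FromSemigroup {ℓ n} {G : Graph n} {S : CommSemigroupWithZero ℓ} (iso : IsoToΓ G S) where
  open CommSemigroupWithZero S
  open IsoToΓ iso
  open ≡-Reasoning

  zeroʳ : ∀ x → x · 0# ≡ 0#
  zeroʳ x = trans (comm x 0#) (zeroˡ x)

  element : Fin (suc n) → Carrier
  element zero    = 0#
  element (suc i) = φ i

  element-injective : ∀ x y → element x ≡ element y → x ≡ y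
  element-injective zero    zero    _  = refl
  element-injective zero    (suc j) eq = ⊥-elim (proj₁ (φ-vert j) (sym eq))
  element-injective (suc i) zero    eq = ⊥-elim (proj₁ (φ-vert i) eq)
  element-injective (suc i) (suc j) eq = cong suc (φ-inj i j eq)

  Product : Fin (suc n) → Fin (suc n) → Set ℓ
  Product x y = Σ (Fin (suc n)) λ z → element x · element y ≡ element z

  product-isNZZD : ∀ i j → φ i · φ j ≢ 0# → IsNZZD (φ i · φ j)
  product-isNZZD i j nonzero with φ-vert j
  ... | _ , y , y≢0 , φj·y≡0 = nonzero , y , y≢0 , (begin
    (φ i · φ j) · y ≡⟨ assoc (φ i) (φ j) y ⟩
    φ i · (φ j · y) ≡⟨ cong (φ i ·_) φj·y≡0 ⟩
    φ i · 0#        ≡⟨ zeroʳ (φ i) ⟩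
    0#              ∎)

  -- Whether a product of two vertices vanishes is undecidable, hence ¬ ¬.
  product-closed : ∀ x y → ¬ ¬ Product x y
  product-closed zero    y       k = k (zero , zeroˡ _)
  product-closed (suc i) zero    k = k (zero , zeroʳ _)
  product-closed (suc i) (suc j) k
    with φ-surj _ (product-isNZZD i j λ vanishes → k (zero , vanishes))
  ... | m , φm≡ = k (suc m , sym φm≡)

  module _ (product : ∀ x y → Product x y) where
    _*_ : Fin (suc n) → Fin (suc n) → Fin (suc n)
    x * y = proj₁ (product x y)

    element-* : ∀ x y → element x · element y ≡ element (x * y)
    element-* x y = proj₂ (product x y)

    *-comm : ∀ x y → x * y ≡ y * x
    *-comm x y = element-injective _ _ (begin
      element (x * y)       ≡⟨ element-* x y ⟨
      element x · element y ≡⟨ comm (element x) (element y) ⟩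
      element y · element x ≡⟨ element-* y x ⟩
      element (y * x)       ∎)

    *-assoc : ∀ x y z → (x * y) * z ≡ x * (y * z)
    *-assoc x y z = element-injective _ _ (begin
      element ((x * y) * z)               ≡⟨ element-* (x * y) z ⟨
      element (x * y) · element z         ≡⟨ cong (_· element z) (element-* x y) ⟨
      (element x · element y) · element z ≡⟨ assoc (element x) (element y) (element z) ⟩
      element x · (element y · element z) ≡⟨ cong (element x ·_) (element-* y z) ⟩
      element x · element (y * z)         ≡⟨ element-* x (y * z) ⟩
      element (x * (y * z))               ∎)

    isZero-* : ∀ x y → element x · element y ≡ 0# → T (isZero (x * y))
    isZero-* x y vanishes
      rewrite element-injective (x * y) zero (trans (sym (element-* x y)) vanishes) = _

    ¬isZero-* : ∀ i j → ¬ φ i · φ j ≡ 0# → T (not (isZero (suc i * suc j)))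
    ¬isZero-* i j nonzero with suc i * suc j in ij
    ... | zero  = nonzero (trans (element-* (suc i) (suc j)) (cong element ij))
    ... | suc _ = _

    permitted-* : ∀ x y → T (permitted G x y (x * y))
    permitted-* zero    y       = isZero-* zero y (zeroˡ _)
    permitted-* (suc i) zero    = isZero-* (suc i) zero (zeroʳ _)
    permitted-* (suc i) (suc j) with i ≟ j | adjacent? G i j
    ... | yes _   | _        = _
    ... | no  i≢j | yes adj  = isZero-* (suc i) (suc j) (Equivalence.to (φ-adj i j i≢j) adj)
    ... | no  i≢j | no  ¬adj = ¬isZero-* i j (¬adj ∘ Equivalence.from (φ-adj i j i≢j))

    table : ZeroDivisorTable G
    table = record { _*_ = _*_ ; *-comm = *-comm ; *-assoc = *-assoc ; permitted-* = permitted-* }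

zeroDivisorGraph⇒¬¬table : ∀ {ℓ n} {G : Graph n} → IsZeroDivisorGraph ℓ G → ¬ ¬ ZeroDivisorTable G
zeroDivisorGraph⇒¬¬table (_ , iso) noTable =
  ¬¬-pull-Fin (λ x → ¬¬-pull-Fin (product-closed x)) (noTable ∘ table)
  where open FromSemigroup iso

Knowledge : ℕ → Set
Knowledge m = Fin m → Fin m → Maybe (Fin m)

insert : ∀ {m} (x y v : Fin m) → Knowledge m → Knowledge m
insert x y v K x′ y′ with x′ ≟ x | y′ ≟ y
... | yes _ | yes _ = just v
... | _     | _     = K x′ y′

learn : ∀ {m} (x y v : Fin m) → Knowledge m → Knowledge m
learn x y v = insert x y v ∘ insert y x v

forced : ∀ {n} → Graph n → Knowledge (suc n)
forced G zero    _       = just zero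
forced G (suc _) zero    = just zero
forced G (suc i) (suc j) with i ≟ j | adjacent? G i j
... | no _ | yes _ = just zero
... | _    | _     = nothing

clashes : ∀ {m} → Maybe (Fin m) → Fin m → Bool
clashes (just u) v = not (isYes (u ≟ v))
clashes nothing  _ = false

-- A refutation tree: `assoc x y z` reads p = x y, q = y z and r = x q off the
-- current knowledge and asserts p z = r; `split x y` branches on the value of
-- x y. The leaf `done` is only reached once a contradiction has been found.
data Refutation (m : ℕ) : Set where
  done  : Refutation m
  assoc : (x y z : Fin m) → Refutation m → Refutation m
  split : (x y : Fin m) → (Fin m → Refutation m) → Refutation m

cases : ∀ {m} → Fin m → Fin m → Vec (Refutation m) m → Refutation m
cases x y ts = split x y (lookup ts)

module _ {n} (G : Graph n) where
  mutual
    refutes : Knowledge (suc n) → Refutation (suc n) → Bool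
    refutes K done = false
    refutes K (assoc x y z t) with K x y | K y z
    ... | just p | just q with K x q
    ...   | just r  = refutesWith K p z r t
    ...   | nothing = false
    refutes K (assoc x y z t) | _ | _ = false
    refutes K (split x y ts) = allᵇ λ v → refutesWith K x y v (ts v)

    refutesWith : Knowledge (suc n) → (x y v : Fin (suc n)) → Refutation (suc n) → Bool
    refutesWith K x y v t = not (permitted G x y v) ∨ clashes (K x y) v ∨ refutes (learn x y v K) t

module _ {n} {G : Graph n} (M : ZeroDivisorTable G) where
  open ZeroDivisorTable M

  Sound : Knowledge (suc n) → Set
  Sound K = ∀ {x y v} → K x y ≡ just v → x * y ≡ v

  forced-sound : Sound (forced G)
  forced-sound {zero}  {y}     refl = isZero⇒≡zero (permitted-* zero y)
  forced-sound {suc i} {zero}  refl = isZero⇒≡zero (permitted-* (suc i) zero)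
  forced-sound {suc i} {suc j} eq with i ≟ j | adjacent? G i j | permitted-* (suc i) (suc j)
  forced-sound {suc i} {suc j} refl | no _ | yes _ | isZero-ij = isZero⇒≡zero isZero-ij
  forced-sound {suc i} {suc j} () | yes _ | _ | _
  forced-sound {suc i} {suc j} () | no _ | no _ | _

  insert-sound : ∀ {K x y v} → x * y ≡ v → Sound K → Sound (insert x y v K)
  insert-sound {x = x} {y} xy≡v K-sound {x′} {y′} eq with x′ ≟ x | y′ ≟ y
  insert-sound xy≡v K-sound refl | yes refl | yes refl = xy≡v
  insert-sound xy≡v K-sound eq   | yes _    | no _     = K-sound eq
  insert-sound xy≡v K-sound eq   | no _     | _        = K-sound eq

  learn-sound : ∀ {K x y v} → x * y ≡ v → Sound K → Sound (learn x y v K)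
  learn-sound {x = x} {y} xy≡v = insert-sound xy≡v ∘ insert-sound (trans (*-comm y x) xy≡v)

  clashes-sound : ∀ {K x y} → Sound K → ¬ T (clashes (K x y) (x * y))
  clashes-sound {K} {x} {y} K-sound clash with K x y in xy
  ... | just u  = toWitnessFalse clash (sym (K-sound xy))
  ... | nothing = clash

  mutual
    refutes-sound : ∀ {K} → Sound K → ∀ t → ¬ T (refutes G K t)
    refutes-sound {K} K-sound (assoc x y z t) holds with K x y in xy | K y z in yz
    ... | just p | just q with K x q in xq
    ...   | just r = refutesWith-sound K-sound t pz≡r holds
      where
      open ≡-Reasoning
      pz≡r : p * z ≡ r
      pz≡r = begin
        p * z       ≡⟨ cong (_* z) (K-sound xy) ⟨
        (x * y) * z ≡⟨ *-assoc x y z ⟩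
        x * (y * z) ≡⟨ cong (x *_) (K-sound yz) ⟩
        x * q       ≡⟨ K-sound xq ⟩
        r           ∎
    refutes-sound K-sound (split x y ts) holds =
      refutesWith-sound {x = x} {y} K-sound (ts (x * y)) refl (allᵇ-sound _ holds (x * y))

    refutesWith-sound : ∀ {K x y v} → Sound K → ∀ t → x * y ≡ v → ¬ T (refutesWith G K x y v t)
    refutesWith-sound {K} {x} {y} K-sound t refl holds with Equivalence.to T-∨ holds
    ... | inj₁ unpermitted = T-not⇒¬T unpermitted (permitted-* x y)
    ... | inj₂ rest with Equivalence.to T-∨ rest
    ...   | inj₂ learnt = refutes-sound (learn-sound refl K-sound) t learnt
    ...   | inj₁ clash  = clashes-sound K-sound clash

record Refuted {n} (G : Graph n) : Set where
  constructor refuted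
  field
    certificate : Refutation (suc n)
    valid       : T (refutes G (forced G) certificate)

refuted⇒¬zeroDivisorGraph : ∀ ℓ {n} {G : Graph n} → Refuted G → ¬ IsZeroDivisorGraph ℓ G
refuted⇒¬zeroDivisorGraph ℓ (refuted t valid) zdg =
  zeroDivisorGraph⇒¬¬table zdg λ M → refutes-sound M (forced-sound M) t valid

belowDegreeOf : ∀ {n} (G : Graph n) u v → {True (degree G v <? degree G u)} → ¬ IsMaxDegree G v
belowDegreeOf G u v {below} isMax = <⇒≱ (toWitness below) (isMax u)

-- Machine-found refutations; `refuted t _` in `pendantRefuted` leaves the
-- validity proof to Agda, which obtains it by evaluating `refutes`.
w a b c d e f : Fin 8
w = suc zero
a = suc (suc Defs.a)
b = suc (suc Defs.b)
c = suc (suc Defs.c)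
d = suc (suc Defs.d)
e = suc (suc Defs.e)
f = suc (suc Defs.f)

refutation₁b : Refutation 8
refutation₁b =
  cases w d (done ∷ assoc w d a done ∷ assoc w d a (assoc w d e done) ∷ assoc d w b (cases w e (done
  ∷ assoc d e w done ∷ assoc w e f done ∷ assoc w e d done ∷ assoc w e d done
  ∷ assoc w e b done ∷ cases w f (done ∷ assoc e f w done ∷ assoc d w f done
  ∷ cases a f (done ∷ assoc d a f done ∷ assoc a f w done ∷ assoc f a d done
  ∷ assoc a f w done ∷ assoc w f a done ∷ assoc w f a done ∷ assoc w f a done
  ∷ []) ∷ assoc w f e done ∷ assoc f w b done ∷ assoc d w f done ∷ assoc f w b done
  ∷ []) ∷ assoc w e b done ∷ [])) ∷ assoc w d a done ∷ assoc d w b done ∷ assoc w d a done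
  ∷ assoc w d a done ∷ [])

refutation₁e : Refutation 8
refutation₁e =
  cases w a (done ∷ assoc w a b done ∷ assoc a w e done ∷ assoc w a b (assoc w a d done)
  ∷ assoc w a d done ∷ assoc w a b done ∷ assoc a w e (cases w b (done ∷ assoc a b w done
  ∷ assoc w b a (assoc w b c done) ∷ cases w c (done ∷ assoc b c w done ∷ assoc c w e done
  ∷ assoc a w c done ∷ assoc c w e done ∷ assoc a w c done ∷ cases c d (done
  ∷ assoc a d c done ∷ assoc w c d done ∷ assoc w c d done ∷ assoc w c d done
  ∷ assoc d c w done ∷ assoc c d a done ∷ assoc c d a done ∷ []) ∷ assoc w c b done
  ∷ []) ∷ assoc w b a done ∷ assoc w b c done ∷ assoc w b a done ∷ assoc w b a done
  ∷ [])) ∷ assoc w a b done ∷ [])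

refutation₂b : Refutation 8
refutation₂b =
  cases w d (done ∷ assoc w d a done ∷ assoc w d a (assoc w d e done) ∷ assoc d w b (cases w c (done
  ∷ assoc d w c done ∷ assoc w c e done ∷ assoc c w d done ∷ assoc c w d done
  ∷ assoc w c b done ∷ assoc w c e (cases w w (assoc c w w done ∷ assoc d w w done
  ∷ cases w a (done ∷ assoc d a w done ∷ assoc w w a (cases w e (done ∷ assoc c e w done
  ∷ assoc w w c (assoc w w e (assoc w e c done)) ∷ assoc w w c (assoc w w e done)
  ∷ assoc w w c (assoc w w e (assoc w a c done)) ∷ assoc w w c (assoc w w e (assoc w a c done))
  ∷ assoc w w c (assoc w w e (cases w f (done ∷ assoc e f w done ∷ assoc e f w done
  ∷ assoc w w f done ∷ assoc w w f (assoc f w c (assoc f w d done)) ∷ assoc w w f (assoc w a f done)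
  ∷ assoc w w f (cases b d (done ∷ assoc w b d done ∷ assoc w b d done ∷ cases c d (done
  ∷ assoc a d c done ∷ assoc a d c done ∷ cases c f (done ∷ assoc e c f done
  ∷ assoc e c f done ∷ assoc d c f done ∷ assoc w c f done ∷ assoc b c f done
  ∷ assoc w c f done ∷ assoc w c f done ∷ []) ∷ assoc a d c done ∷ assoc b c d done
  ∷ assoc a d c done ∷ assoc a d c done ∷ []) ∷ assoc w b d done ∷ assoc w b d done
  ∷ assoc w b d done ∷ assoc w b d done ∷ [])) ∷ assoc w w f (assoc f w c done)
  ∷ []))) ∷ assoc w w c (assoc w e c done) ∷ [])) ∷ assoc c w a done ∷ assoc w w a (assoc w a d
  done) ∷ assoc w w a (assoc w a b done) ∷ assoc c w a done ∷ assoc w a d done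
  ∷ []) ∷ assoc c w w done ∷ assoc w w d done ∷ assoc w w b done ∷ assoc c w w done
  ∷ assoc w w d done ∷ [])) ∷ assoc c w d done ∷ [])) ∷ assoc w d a done ∷ assoc d w b done
  ∷ assoc w d a done ∷ assoc w d a done ∷ [])

refutation₂e : Refutation 8
refutation₂e =
  cases w a (done ∷ assoc w a b done ∷ assoc a w e done ∷ assoc w a b (assoc w a d done)
  ∷ assoc w a d done ∷ assoc w a b done ∷ assoc a w e (cases w b (done ∷ assoc a b w done
  ∷ assoc w b a (assoc w b c done) ∷ cases w c (done ∷ assoc b c w done ∷ assoc w c e done
  ∷ assoc w c b (cases w w (assoc b w w done ∷ assoc a w w done ∷ assoc b w w done
  ∷ assoc b w w done ∷ assoc b w w done ∷ assoc w w b (assoc w w c (cases w d (done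
  ∷ assoc a d w done ∷ assoc b w d done ∷ assoc b w d done ∷ assoc b w d done
  ∷ assoc w w d (cases w f (done ∷ assoc b f w done ∷ assoc w w f (assoc w d f done)
  ∷ assoc w w f (cases a a (assoc w a a done ∷ assoc b a a done ∷ assoc w a a (cases a c (done
  ∷ assoc b a c done ∷ assoc e c a done ∷ assoc d a c done ∷ assoc d a c done
  ∷ assoc b a c done ∷ cases c f (done ∷ assoc b c f done ∷ assoc e c f done
  ∷ assoc w c f done ∷ assoc w c f done ∷ assoc b c f done ∷ assoc a c f done
  ∷ assoc w c f done ∷ []) ∷ assoc d a c done ∷ [])) ∷ assoc d a a done ∷ assoc d a a done
  ∷ assoc b a a done ∷ assoc w a a done ∷ assoc d a a done ∷ [])) ∷ assoc w w f (assoc f w a done)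
  ∷ assoc b f w done ∷ assoc w w f done ∷ assoc w w f (assoc f w a done) ∷ []))
  ∷ assoc b w d done ∷ assoc b w d done ∷ []))) ∷ assoc b w w done ∷ assoc b w w done
  ∷ [])) ∷ assoc c w a done ∷ assoc w c b done ∷ assoc c w a done ∷ assoc c w a done
  ∷ []) ∷ assoc w b a done ∷ assoc w b c done ∷ assoc w b a done ∷ assoc w b a done
  ∷ [])) ∷ assoc w a d done ∷ [])

refutation₃b : Refutation 8
refutation₃b =
  cases w d (done ∷ assoc w d c done ∷ assoc w d c done ∷ assoc w d b (assoc w d e done)
  ∷ assoc w d c (assoc w d e done) ∷ cases w f (done ∷ assoc d f w done ∷ assoc w f a (assoc w f d
  done) ∷ assoc w f b (assoc w f e done) ∷ assoc w f a done ∷ assoc w f a done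
  ∷ assoc w f a done ∷ cases w w (assoc d w w done ∷ cases a d (done ∷ assoc f a d done
  ∷ assoc a d w (assoc a d c done) ∷ assoc w d a done ∷ assoc a d w (assoc a d c (assoc a d e done))
  ∷ cases b e (done ∷ assoc w b e done ∷ assoc d b e done ∷ cases c f (done ∷ assoc d c f done
  ∷ assoc d c f done ∷ assoc e f c done ∷ assoc c f w (assoc c f a done) ∷ assoc a f c done
  ∷ assoc b c f done ∷ cases w a (done ∷ assoc f a w done ∷ cases w c (done ∷ assoc d c w done
  ∷ assoc d c w done ∷ assoc f w c done ∷ cases w e (done ∷ assoc d e w done
  ∷ assoc d e w done ∷ assoc w w e done ∷ assoc f e w done ∷ assoc a w e (assoc c w e done)
  ∷ assoc b w e done ∷ assoc a w e done ∷ []) ∷ assoc f w c done ∷ assoc b w c done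
  ∷ assoc a w c done ∷ []) ∷ assoc d w a done ∷ assoc f a w done ∷ assoc w a d (cases w c (done
  ∷ assoc d c w done ∷ assoc d c w done ∷ assoc f w c done ∷ assoc c w a done
  ∷ assoc d c w done ∷ assoc b w c done ∷ assoc w c f (cases w e (done ∷ assoc d e w done
  ∷ assoc d e w done ∷ assoc w w e done ∷ assoc f e w done ∷ assoc d e w done
  ∷ assoc b w e done ∷ assoc f e w done ∷ [])) ∷ [])) ∷ assoc b w a done ∷ assoc d w a done
  ∷ []) ∷ []) ∷ assoc b e f done ∷ assoc w b e done ∷ assoc e b w done ∷ assoc w b e done
  ∷ []) ∷ assoc a d w (assoc a d b done) ∷ assoc a d c done ∷ []) ∷ assoc f w w done
  ∷ assoc d w w done ∷ assoc d w w done ∷ assoc f w w done ∷ assoc d w w done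
  ∷ assoc d w w done ∷ []) ∷ []) ∷ assoc w d b done ∷ assoc w d c done ∷ [])

refutation₃d : Refutation 8
refutation₃d =
  cases w b (done ∷ assoc w b a done ∷ assoc w b a (assoc w b c done) ∷ cases w f (done
  ∷ assoc b f w done ∷ assoc w f a (assoc w f d done) ∷ assoc w f b (assoc w f e done)
  ∷ assoc w f a done ∷ assoc w f a done ∷ assoc w f a done ∷ cases w w (assoc b w w done
  ∷ cases a d (done ∷ assoc w d a done ∷ assoc a d w done ∷ assoc w d a done
  ∷ assoc a d w done ∷ cases b e (done ∷ assoc f b e done ∷ assoc d b e done
  ∷ cases c f (done ∷ assoc b c f done ∷ assoc d c f done ∷ assoc e f c done
  ∷ assoc c f w (assoc c f a done) ∷ assoc a f c done ∷ assoc b c f done ∷ cases w a (done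
  ∷ assoc b a w done ∷ assoc d w a done ∷ assoc w a b (cases w c (done ∷ assoc b c w done
  ∷ assoc d w c done ∷ assoc f w c done ∷ assoc c w a done ∷ assoc f w c done
  ∷ assoc b c w done ∷ assoc w c f (cases w e (done ∷ assoc f e w done ∷ assoc d w e done
  ∷ assoc b w e done ∷ assoc f e w done ∷ assoc b w e done ∷ assoc e w a (assoc e w c done)
  ∷ assoc f e w done ∷ [])) ∷ [])) ∷ assoc f a w done ∷ assoc w w a done ∷ assoc b a w done
  ∷ assoc w a f (cases w c (done ∷ assoc b c w done ∷ assoc d w c done ∷ assoc f w c done
  ∷ assoc c w a (cases w e (done ∷ assoc f e w done ∷ assoc d w e done ∷ assoc c w e done
  ∷ assoc f e w done ∷ assoc b w e done ∷ assoc e w a done ∷ assoc b w e done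
  ∷ [])) ∷ assoc f w c done ∷ assoc b c w done ∷ assoc f w c done ∷ [])) ∷ [])
  ∷ []) ∷ assoc b e f done ∷ assoc a b e done ∷ assoc e b w (assoc e b a done)
  ∷ assoc b e f (assoc e b c done) ∷ []) ∷ assoc a d w done ∷ assoc w d a done
  ∷ []) ∷ assoc b w w done ∷ assoc f w w done ∷ assoc b w w done ∷ assoc b w w done
  ∷ assoc f w w done ∷ assoc b w w done ∷ []) ∷ []) ∷ assoc w b a done ∷ assoc w b a done
  ∷ assoc w b a done ∷ assoc w b c done ∷ [])

refutation₃f : Refutation 8
refutation₃f =
  cases w b (done ∷ assoc w b a done ∷ assoc w b a (assoc w b c done) ∷ cases w d (done
  ∷ assoc b d w done ∷ assoc w d c done ∷ assoc w d b (assoc w d e done) ∷ assoc w d c (assoc w d e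
  done) ∷ cases w w (assoc b w w done ∷ cases a d (done ∷ assoc b a d done ∷ assoc a d w (assoc a d
  c done) ∷ assoc a d b (assoc a d e done) ∷ assoc a d w (assoc a d c (assoc a d e done))
  ∷ cases b e (done ∷ assoc d b e done ∷ assoc d b e done ∷ cases c f (done ∷ assoc w f c done
  ∷ assoc d c f done ∷ assoc w f c done ∷ assoc c f w done ∷ assoc w f c done
  ∷ assoc b c f done ∷ cases w a (done ∷ assoc b a w done ∷ cases w c (done ∷ assoc b c w done
  ∷ assoc d c w done ∷ assoc a w c done ∷ assoc f w c done ∷ assoc a w c (assoc w c d (cases w e
  (done ∷ assoc d e w done ∷ assoc d e w done ∷ assoc a w e done ∷ assoc f w e done
  ∷ assoc b w e done ∷ assoc e w c done ∷ assoc b w e done ∷ []))) ∷ assoc b c w done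
  ∷ assoc w w c done ∷ []) ∷ assoc d w a done ∷ assoc f w a done ∷ assoc w a d (cases w c (done
  ∷ assoc b c w done ∷ assoc d c w done ∷ assoc w c b (cases w e (done ∷ assoc d e w done
  ∷ assoc d e w done ∷ assoc b w e done ∷ assoc f w e done ∷ assoc d e w done
  ∷ assoc e w a done ∷ assoc b w e done ∷ [])) ∷ assoc f w c done ∷ assoc d c w done
  ∷ assoc b c w done ∷ assoc w w c done ∷ [])) ∷ assoc b a w done ∷ assoc d w a done
  ∷ []) ∷ []) ∷ assoc b e f done ∷ assoc a b e done ∷ assoc e b w (assoc e b a done)
  ∷ assoc w b e done ∷ []) ∷ assoc a d w (assoc a d b done) ∷ assoc w d a done
  ∷ []) ∷ assoc b w w done ∷ assoc d w w done ∷ assoc b w w done ∷ assoc b w w done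
  ∷ assoc d w w done ∷ assoc b w w done ∷ []) ∷ assoc w d b done ∷ assoc w d c done
  ∷ []) ∷ assoc w b a done ∷ assoc w b a done ∷ assoc w b a done ∷ assoc w b c done
  ∷ [])

refutation₄b : Refutation 8
refutation₄b =
  cases b d (done ∷ assoc b d c done ∷ assoc b d c done ∷ cases w c (done ∷ assoc w c d done
  ∷ assoc w c d done ∷ assoc d c w done ∷ cases w a (done ∷ assoc c w a (assoc w a f done)
  ∷ cases w w (assoc c w w done ∷ cases w f (done ∷ assoc a f w done ∷ assoc w f a (assoc w f c
  done) ∷ assoc w w f done ∷ assoc w f a done ∷ assoc b w f done ∷ assoc w f a done
  ∷ cases w d (done ∷ assoc c d w done ∷ assoc f w d done ∷ assoc a w d done
  ∷ assoc f w d done ∷ assoc b w d done ∷ assoc f w d done ∷ assoc a w d done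
  ∷ []) ∷ []) ∷ assoc w w a (assoc w w c (cases w f (done ∷ assoc a f w done
  ∷ assoc a f w done ∷ assoc w f b (cases w d (done ∷ assoc c d w done ∷ assoc c d w done
  ∷ assoc a w d done ∷ assoc a w d (assoc f w d done) ∷ assoc b w d done ∷ assoc f w d done
  ∷ assoc a w d done ∷ [])) ∷ assoc a f w done ∷ assoc b w f done ∷ assoc w f a done
  ∷ assoc w w f done ∷ []))) ∷ assoc c w w done ∷ assoc w w a (assoc w w c (assoc a c d done))
  ∷ assoc b w w done ∷ assoc c w w done ∷ assoc c w w done ∷ []) ∷ assoc c w a done
  ∷ cases w e (done ∷ assoc c e w done ∷ assoc w e c done ∷ assoc d e w done
  ∷ assoc w e c (assoc e w a done) ∷ assoc b w e done ∷ assoc e w a done ∷ assoc w e d done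
  ∷ []) ∷ assoc b w a done ∷ assoc c w a done ∷ assoc c w a done ∷ []) ∷ assoc b w c done
  ∷ assoc w c e (cases c c (cases w a (done ∷ assoc c w a (assoc w a f done)
  ∷ cases a c (done ∷ assoc c w a (assoc c c a done) ∷ assoc w c a (assoc e e a done)
  ∷ assoc d c a done ∷ assoc w c a (assoc c w a done) ∷ assoc b a c done ∷ assoc c w a (assoc a c w
  (cases a a (assoc c a a done ∷ assoc a a w (assoc a a f done) ∷ cases a d (done
  ∷ assoc c d a done ∷ assoc c d a done ∷ assoc w a d done ∷ assoc w a d done
  ∷ assoc b a d done ∷ cases d d (assoc b d d done ∷ assoc c d d done ∷ assoc c d d done
  ∷ assoc d d b (cases d f (done ∷ assoc a f d done ∷ assoc a f d done ∷ assoc b f d done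
  ∷ assoc a f d done ∷ assoc a f d done ∷ assoc a f d done ∷ assoc d d f done
  ∷ [])) ∷ assoc b d d done ∷ assoc a d d done ∷ assoc b d d done ∷ assoc b d d done
  ∷ []) ∷ assoc a a d done ∷ []) ∷ assoc w a a done ∷ assoc w a a done ∷ assoc b a a done
  ∷ assoc c a a done ∷ assoc c a a done ∷ []))) ∷ assoc c w a (assoc a c w (assoc a c d done))
  ∷ []) ∷ assoc c w a done ∷ assoc c w a done ∷ assoc b w a done ∷ assoc c w a done
  ∷ assoc c w a done ∷ []) ∷ assoc c c w (assoc c c d done) ∷ assoc c c w done
  ∷ assoc d c c done ∷ assoc w c c done ∷ assoc b c c done ∷ assoc c c w done
  ∷ assoc c c w done ∷ [])) ∷ assoc w c d done ∷ []) ∷ assoc b d c (assoc d b w done)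
  ∷ assoc d b w done ∷ assoc b d e (assoc d b w done) ∷ assoc d b w done ∷ [])

refutation₄c : Refutation 8
refutation₄c =
  cases a c (done ∷ assoc a c w (assoc a c b done) ∷ assoc a c w done ∷ assoc a c w done
  ∷ cases w b (done ∷ assoc w b a done ∷ assoc c w b done ∷ cases w d (done ∷ assoc b w d (assoc w d
  e done) ∷ assoc c w d done ∷ cases w f (done ∷ assoc b f w done ∷ assoc c w f done
  ∷ assoc w f b (assoc f w d done) ∷ assoc a f w done ∷ assoc w f a done ∷ assoc w f a done
  ∷ assoc f w d done ∷ []) ∷ assoc b w d done ∷ cases w w (assoc b w w done ∷ cases w e (done
  ∷ assoc b e w done ∷ assoc c w e done ∷ assoc w e b (assoc w e d done) ∷ assoc w w e done
  ∷ assoc w e b done ∷ cases w a (done ∷ assoc b a w done ∷ assoc c w a done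
  ∷ assoc e w a done ∷ assoc d w a done ∷ assoc e w a done ∷ assoc d w a done
  ∷ assoc e w a done ∷ []) ∷ assoc w e d done ∷ []) ∷ assoc c w w done ∷ assoc w w b (assoc w w d
  (assoc d b a done)) ∷ assoc b w w done ∷ assoc w w b (assoc w w d (cases w e (done
  ∷ assoc b e w done ∷ assoc c w e done ∷ assoc d e w done ∷ assoc w e c (cases w a (done
  ∷ assoc b a w done ∷ assoc c w a done ∷ assoc d w a (assoc e w a done) ∷ assoc d w a done
  ∷ assoc b a w done ∷ assoc d w a done ∷ assoc e w a done ∷ [])) ∷ assoc b e w done
  ∷ assoc w w e done ∷ assoc w e d done ∷ []))) ∷ assoc b w w done ∷ assoc b w w done
  ∷ []) ∷ assoc b w d done ∷ assoc b w d done ∷ []) ∷ assoc a b w done ∷ assoc w b a done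
  ∷ assoc w b a done ∷ assoc w b f (cases b b (cases w d (done ∷ assoc b w d (assoc w d e done)
  ∷ assoc c w d done ∷ assoc b w d done ∷ assoc b w d done ∷ cases b d (done
  ∷ assoc b w d (assoc b b d done) ∷ assoc c b d done ∷ assoc w b d (assoc b w d done)
  ∷ assoc a b d done ∷ assoc w b d (assoc f f d done) ∷ assoc b w d (assoc b d w (assoc b d e (assoc
  d b a done))) ∷ assoc b w d (assoc b d w (cases d d (assoc b d d done ∷ assoc d d w (assoc d d e
  done) ∷ assoc c d d done ∷ assoc w d d done ∷ assoc w d d done ∷ cases a d (done
  ∷ assoc b a d done ∷ assoc c d a done ∷ assoc w d a done ∷ assoc w d a done
  ∷ assoc b a d done ∷ assoc d d a done ∷ cases a a (assoc c a a done ∷ assoc b a a done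
  ∷ assoc d a a done ∷ assoc c a a done ∷ assoc a a c (cases a e (done ∷ assoc b a e done
  ∷ assoc c e a done ∷ assoc d e a done ∷ assoc c e a done ∷ assoc b a e done
  ∷ assoc a a e done ∷ assoc d e a done ∷ [])) ∷ assoc b a a done ∷ assoc c a a done
  ∷ assoc c a a done ∷ []) ∷ []) ∷ assoc b d d done ∷ assoc b d d done ∷ [])))
  ∷ []) ∷ assoc b w d done ∷ assoc b w d done ∷ []) ∷ assoc b b w (assoc b b a done)
  ∷ assoc c b b done ∷ assoc w b b done ∷ assoc a b b done ∷ assoc b b w done
  ∷ assoc b b w done ∷ assoc b b w done ∷ [])) ∷ []) ∷ assoc a c w done ∷ assoc a c w done
  ∷ assoc a c w done ∷ [])

refutation₄e : Refutation 8
refutation₄e =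
  cases a e (done ∷ assoc a e w (assoc a e b done) ∷ assoc a e w done ∷ assoc a e w done
  ∷ assoc a e w done ∷ assoc a e w done ∷ cases w b (done ∷ assoc w b a done
  ∷ assoc e w b done ∷ cases w c (done ∷ assoc b c w done ∷ assoc e w c done
  ∷ assoc w c b (assoc w c d done) ∷ cases w w (assoc b w w done ∷ cases w a (done
  ∷ assoc b a w done ∷ assoc e w a done ∷ assoc c w a done ∷ cases w d (done
  ∷ assoc c d w done ∷ assoc e w d done ∷ cases w f (done ∷ assoc a f w done
  ∷ assoc e w f done ∷ assoc w f b (assoc f w d done) ∷ assoc w f a done ∷ assoc w w f done
  ∷ assoc a f w done ∷ assoc f w d done ∷ []) ∷ assoc b w d done ∷ assoc d w a done
  ∷ assoc b w d done ∷ assoc b w d done ∷ []) ∷ assoc c w a done ∷ assoc c w a done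
  ∷ assoc c w a done ∷ []) ∷ assoc e w w done ∷ assoc c w w done ∷ assoc b w w done
  ∷ assoc c w w done ∷ assoc b w w done ∷ assoc b w w done ∷ []) ∷ assoc w c b done
  ∷ assoc w c e (cases w a (done ∷ assoc b a w done ∷ assoc e w a done ∷ assoc c w a done
  ∷ assoc a w c (cases w w (assoc b w w done ∷ assoc c w w done ∷ assoc e w w done
  ∷ assoc a w w done ∷ assoc b w w done ∷ assoc w w a (assoc w w b (cases w d (done
  ∷ assoc c d w done ∷ assoc e w d done ∷ assoc w w d (assoc w d b (cases w f (done
  ∷ assoc a f w done ∷ assoc e w f done ∷ assoc b f w done ∷ assoc c f w done
  ∷ assoc a f w done ∷ assoc a f w done ∷ assoc w w f (assoc w d f done) ∷ [])))
  ∷ assoc c d w done ∷ assoc a w d done ∷ assoc b w d done ∷ assoc b w d done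
  ∷ []))) ∷ assoc b w w done ∷ assoc b w w done ∷ [])) ∷ assoc c w a done ∷ assoc c w a done
  ∷ assoc c w a done ∷ [])) ∷ assoc w c d done ∷ []) ∷ assoc w b a done ∷ assoc w b a done
  ∷ assoc a b w done ∷ assoc w b f (cases b b (cases w d (done ∷ assoc b w d (assoc w d c done)
  ∷ assoc e w d done ∷ assoc b w d done ∷ assoc b w d done ∷ cases b d (done
  ∷ assoc b w d (assoc b b d done) ∷ assoc e b d done ∷ assoc w b d (assoc b w d done)
  ∷ assoc b w d (assoc b d w (assoc b d c (assoc d b a done))) ∷ assoc w b d (assoc f f d done)
  ∷ assoc a b d done ∷ assoc b w d (assoc b d w (cases d d (assoc b d d done
  ∷ assoc d d w (assoc d d c done) ∷ assoc e d d done ∷ assoc w d d done ∷ assoc b d d done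
  ∷ cases a d (done ∷ assoc b a d done ∷ assoc e d a done ∷ assoc w d a done
  ∷ assoc d d a done ∷ assoc b a d done ∷ assoc w d a done ∷ cases a a (assoc e a a done
  ∷ assoc b a a done ∷ assoc d a a done ∷ assoc e a a done ∷ assoc e a a done
  ∷ assoc b a a done ∷ assoc a a e (cases a c (done ∷ assoc b a c done ∷ assoc d c a done
  ∷ assoc d c a done ∷ assoc a a c done ∷ assoc b a c done ∷ assoc e c a done
  ∷ assoc d c a done ∷ [])) ∷ assoc e a a done ∷ []) ∷ []) ∷ assoc w d d done
  ∷ assoc b d d done ∷ []))) ∷ []) ∷ assoc b w d done ∷ assoc b w d done ∷ [])
  ∷ assoc b b w (assoc b b a done) ∷ assoc e b b done ∷ assoc w b b done ∷ assoc b b w done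
  ∷ assoc b b w done ∷ assoc a b b done ∷ assoc b b w done ∷ [])) ∷ []) ∷ assoc a e w done
  ∷ [])

refutation₄f : Refutation 8
refutation₄f =
  cases d f (done ∷ assoc d f w (assoc d f a done) ∷ assoc d f w done ∷ assoc d f w done
  ∷ assoc d f w done ∷ assoc d f w done ∷ assoc d f w done ∷ cases w b (done
  ∷ assoc w b a done ∷ assoc w b a (assoc w b c done) ∷ cases w d (done ∷ assoc b w d (assoc w d c
  done) ∷ assoc b w d done ∷ cases a d (done ∷ assoc b a d done ∷ assoc a d w done
  ∷ assoc w d a done ∷ assoc a d w done ∷ assoc f a d done ∷ assoc a d w done
  ∷ assoc a d f (cases b b (assoc b w d done ∷ assoc b w d (assoc b b w (assoc b b a done))
  ∷ assoc b w d (assoc b b w (assoc b b a (assoc b b c done))) ∷ assoc b w d (cases d d (assoc f d d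
  done ∷ assoc f d d done ∷ assoc f d d done ∷ assoc f d d done ∷ assoc f d d done
  ∷ cases w w (assoc b w w done ∷ cases w a (done ∷ assoc b a w done ∷ assoc d w a done
  ∷ assoc b a w done ∷ assoc a w w (cases w e (done ∷ assoc b e w done ∷ assoc d e w done
  ∷ assoc b e w done ∷ assoc w e c (assoc e w a done) ∷ assoc b e w done ∷ assoc e w a done
  ∷ assoc d e w done ∷ [])) ∷ assoc b a w done ∷ assoc a w w (cases w c (done
  ∷ assoc b c w done ∷ assoc d c w done ∷ assoc b c w done ∷ assoc c w a done
  ∷ assoc b c w done ∷ assoc w c e (assoc c w a done) ∷ assoc d c w done ∷ []))
  ∷ assoc d w a done ∷ []) ∷ assoc b w w done ∷ cases w a (done ∷ assoc b a w done
  ∷ assoc d w a done ∷ assoc b a w done ∷ assoc a w w done ∷ assoc b a w done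
  ∷ assoc a w w done ∷ assoc d w a done ∷ []) ∷ assoc b w w done ∷ assoc f w w done
  ∷ assoc b w w done ∷ assoc b w w done ∷ []) ∷ assoc f d d done ∷ assoc f d d done
  ∷ [])) ∷ assoc b w d (assoc b b w (assoc b b a done)) ∷ assoc a b b done ∷ assoc b w d (assoc b b
  w (assoc b b a done)) ∷ assoc w b b done ∷ [])) ∷ []) ∷ assoc b w d done ∷ assoc f w d done
  ∷ assoc b w d done ∷ assoc b w d done ∷ []) ∷ assoc w b a done ∷ assoc f w b done
  ∷ assoc w b a done ∷ assoc w b f (cases w d (done ∷ assoc w d c done ∷ assoc b w d done
  ∷ assoc d w b (cases a d (done ∷ assoc b a d done ∷ assoc a d w done ∷ assoc b a d done
  ∷ assoc a d w done ∷ assoc f a d done ∷ assoc a d w done ∷ cases b d (done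
  ∷ assoc b d w (assoc b d a done) ∷ assoc b b d done ∷ cases d d (assoc f d d done
  ∷ assoc f d d done ∷ assoc f d d done ∷ assoc f d d done ∷ assoc f d d done
  ∷ cases w w (assoc d w w done ∷ assoc b w w done ∷ cases w a (done ∷ assoc b a w done
  ∷ assoc d w a done ∷ assoc b a w done ∷ cases w e (done ∷ assoc b e w done
  ∷ assoc d e w done ∷ assoc b e w done ∷ assoc w e c (assoc e w a done) ∷ assoc b e w done
  ∷ assoc w w e (assoc w a e done) ∷ assoc d e w done ∷ []) ∷ assoc b a w done
  ∷ cases w c (done ∷ assoc b c w done ∷ assoc d c w done ∷ assoc b c w done
  ∷ assoc w w c (assoc w a c done) ∷ assoc b c w done ∷ assoc w c e (assoc c w a done)
  ∷ assoc d c w done ∷ []) ∷ assoc d w a done ∷ []) ∷ assoc b w w done ∷ assoc d w w done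
  ∷ assoc f w w done ∷ assoc d w w done ∷ cases w a (done ∷ assoc b a w done
  ∷ assoc d w a done ∷ assoc b a w done ∷ assoc a w w done ∷ assoc b a w done
  ∷ assoc a w w done ∷ assoc d w a done ∷ []) ∷ []) ∷ assoc f d d done ∷ assoc f d d done
  ∷ []) ∷ assoc b b d done ∷ assoc a b d done ∷ assoc b b d done ∷ assoc w b d done
  ∷ []) ∷ [])) ∷ assoc b w d done ∷ assoc f w d done ∷ assoc b w d done ∷ assoc b w d done
  ∷ [])) ∷ []) ∷ [])

pendantRefuted : (k : Fin 4) (v : Fin 6) → IsMaxDegree (graphs k) v → Refuted (addPendant (graphs k) v)
pendantRefuted 0F 0F isMax = ⊥-elim (belowDegreeOf G₁ Defs.b Defs.a isMax)
pendantRefuted 0F 1F _     = refuted refutation₁b _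
pendantRefuted 0F 2F isMax = ⊥-elim (belowDegreeOf G₁ Defs.b Defs.c isMax)
pendantRefuted 0F 3F isMax = ⊥-elim (belowDegreeOf G₁ Defs.b Defs.d isMax)
pendantRefuted 0F 4F _     = refuted refutation₁e _
pendantRefuted 0F 5F isMax = ⊥-elim (belowDegreeOf G₁ Defs.b Defs.f isMax)
pendantRefuted 1F 0F isMax = ⊥-elim (belowDegreeOf G₂ Defs.b Defs.a isMax)
pendantRefuted 1F 1F _     = refuted refutation₂b _
pendantRefuted 1F 2F isMax = ⊥-elim (belowDegreeOf G₂ Defs.b Defs.c isMax)
pendantRefuted 1F 3F isMax = ⊥-elim (belowDegreeOf G₂ Defs.b Defs.d isMax)
pendantRefuted 1F 4F _     = refuted refutation₂e _
pendantRefuted 1F 5F isMax = ⊥-elim (belowDegreeOf G₂ Defs.b Defs.f isMax)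
pendantRefuted 2F 0F isMax = ⊥-elim (belowDegreeOf G₃ Defs.b Defs.a isMax)
pendantRefuted 2F 1F _     = refuted refutation₃b _
pendantRefuted 2F 2F isMax = ⊥-elim (belowDegreeOf G₃ Defs.b Defs.c isMax)
pendantRefuted 2F 3F _     = refuted refutation₃d _
pendantRefuted 2F 4F isMax = ⊥-elim (belowDegreeOf G₃ Defs.b Defs.e isMax)
pendantRefuted 2F 5F _     = refuted refutation₃f _
pendantRefuted 3F 0F isMax = ⊥-elim (belowDegreeOf G₄ Defs.b Defs.a isMax)
pendantRefuted 3F 1F _     = refuted refutation₄b _
pendantRefuted 3F 2F _     = refuted refutation₄c _
pendantRefuted 3F 3F isMax = ⊥-elim (belowDegreeOf G₄ Defs.b Defs.d isMax)
pendantRefuted 3F 4F _     = refuted refutation₄e _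
pendantRefuted 3F 5F _     = refuted refutation₄f _

mainTheorem10 : (ℓ : Level) (k : Fin 4) (v : Fin 6) →
    IsMaxDegree (graphs k) v →
    ¬ IsZeroDivisorGraph ℓ (addPendant (graphs k) v)
mainTheorem10 ℓ k v isMax = refuted⇒¬zeroDivisorGraph ℓ (pendantRefuted k v isMax)
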